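{- Let $n,m$ be positive integers and let $X$ and $Y$ be finite sets of integers with $|X|\ge n(m+1)$. Then either (1) there exist $x_1,\dots,x_n\in X$ and $y_1,\dots,y_n\in Y$ with $x_1<y_1<x_2<y_2<\dots<x_n<y_n$, or (2) there exist $x_1,\dots,x_m\in X$ with $x_1<x_2<\dots<x_m$ and $Y\cap[x_1,x_m]=\emptyset$.
   Context: For integers $x,y$, $[x,y]$ denotes the set of integers $z$ with $x\le z\le y$. -}

module Defs where

open import Data.Nat using (ℕ; suc)
open import Data.Integer using (ℤ; _<_; _≤_)
open import Data.Fin using (Fin; zero; suc; inject₁; fromℕ)
open import Data.List using (List)
open import Data.List.Membership.Propositional using (_∈_)
open import Data.Product using (_×_)
open import Relation.Nullary using (¬_)

-- A finite set of integers is represented by a duplicate-free list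
-- (Data.List.Relation.Unary.Unique); its cardinality is the list length.

Interleaved : (n : ℕ) → List ℤ → List ℤ → (Fin n → ℤ) → (Fin n → ℤ) → Set
Interleaved n X Y xs ys =
  (∀ i → xs i ∈ X) × (∀ i → ys i ∈ Y) × (∀ i → xs i < ys i)
  × (∀ (i : Fin n) (j : Fin n) → Data.Fin.toℕ j ≡ suc (Data.Fin.toℕ i) → ys i < xs j)
  where open import Relation.Binary.PropositionalEquality using (_≡_)

-- Alternative (2): x₁ < x₂ < … < x_m in X (here m = suc k, indices Fin (suc k))
-- with Y ∩ [x₁, x_m] = ∅.
GapChain : (k : ℕ) → List ℤ → List ℤ → (Fin (suc k) → ℤ) → Set
GapChain k X Y xs =
  (∀ i → xs i ∈ X)
  × (∀ (i : Fin k) → xs (inject₁ i) < xs (suc i))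
  × (∀ y → y ∈ Y → ¬ (xs zero ≤ y × y ≤ xs (fromℕ k)))

module Submission where

-- Sort X increasingly as x₀ < x₁ < ….  Cut off the least
-- element b and the window W of the next m = k + 1 elements.  Either no
-- y ∈ Y lies between the first and the last element of W, and W itself is
-- the chain of alternative (2); or some y ∈ Y does, and then b < y < every
-- element beyond W.  In the second case the pair (b , y) is the first link
-- of an interleaving, and the remaining elements (at least n(m+1) of them
-- when |X| ≥ (n+1)(m+1)) are handled recursively: alternative (2) found
-- there is inherited, and an interleaving found there is extended by
-- (b , y) in front.
--
-- The core induction is
-- stated for strictly increasing lists, and the theorem follows by
-- sorting X, which is strictly increasing because X has no duplicates.

open import Defs
open import Data.Nat using (ℕ; suc; _*_; _+_; _≥_)
open import Data.Integer using (ℤ)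
open import Data.Fin using (Fin)
open import Data.List using (List; length)
open import Data.List.Relation.Unary.Unique.Propositional using (Unique)
open import Data.Product using (∃₂; ∃)
open import Data.Sum using (_⊎_)

open import Data.Nat as ℕ using (zero; s≤s)
import Data.Nat.Properties as ℕ
open import Data.Integer as ℤ using (_<_; _≤_; _≤?_)
import Data.Integer.Properties as ℤ
open import Data.Fin using (zero; suc; toℕ; inject₁; fromℕ)
open import Data.Vec.Functional using () renaming (_∷_ to _∷ᶠ_)
open import Data.List using (_∷_; drop)
open import Data.List.Properties using (length-drop)
open import Data.List.Membership.Propositional using (_∈_; lose; find)
open import Data.List.Relation.Unary.Any using (here; there; any?)
open import Data.List.Relation.Unary.All as All using (All)
open import Data.List.Relation.Unary.AllPairs as AllPairs using (AllPairs; _∷_)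
import Data.List.Relation.Unary.AllPairs.Properties as AllPairsₚ
open import Data.List.Relation.Unary.Linked.Properties using (Linked⇒AllPairs)
open import Data.List.Relation.Binary.Subset.Propositional using (_⊆_)
open import Data.List.Relation.Binary.Sublist.Propositional as Sublist using ()
open import Data.List.Relation.Binary.Sublist.Propositional.Properties using (drop-⊆)
open import Data.List.Relation.Binary.Permutation.Propositional using (↭-sym; ↭⇒↭ₛ)
open import Data.List.Relation.Binary.Permutation.Propositional.Properties using (∈-resp-↭; ↭-length)
import Data.List.Relation.Binary.Permutation.Setoid.Properties as Permutationₛ
open import Data.List.Sort ℤ.≤-decTotalOrder using (sort; sort-↭; sort-↗)
open import Data.Product using (_,_; _×_)
open import Data.Sum using (inj₁; inj₂)
open import Relation.Nullary using (¬_; yes; no)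
open import Relation.Nullary.Decidable using (_×-dec_)
open import Relation.Binary.PropositionalEquality using (_≡_; refl; subst; sym; trans; cong; setoid)

Increasing : List ℤ → Set
Increasing = AllPairs _<_

Alternatives : (n k : ℕ) → List ℤ → List ℤ → Set
Alternatives n k X Y =
  (∃₂ λ (xs ys : Fin (suc n) → ℤ) → Interleaved (suc n) X Y xs ys)
  ⊎ (∃ λ (xs : Fin (suc k) → ℤ) → GapChain k X Y xs)

-- Both alternatives only mention membership in X, so they survive
-- enlarging X; this lets a recursive call on a sublist serve the whole.
interleaved-⊆ : ∀ {n} {X X′ Y : List ℤ} {xs ys : Fin n → ℤ} → X ⊆ X′
  → Interleaved n X Y xs ys → Interleaved n X′ Y xs ys
interleaved-⊆ X⊆X′ (xs∈X , ys∈Y , xs<ys , ys<next) = (λ i → X⊆X′ (xs∈X i)) , ys∈Y , xs<ys , ys<next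

gapChain-⊆ : ∀ {k} {X X′ Y : List ℤ} {xs : Fin (suc k) → ℤ} → X ⊆ X′
  → GapChain k X Y xs → GapChain k X′ Y xs
gapChain-⊆ X⊆X′ (xs∈X , increasing , gap) = (λ i → X⊆X′ (xs∈X i)) , increasing , gap

alternatives-⊆ : ∀ {n k} {X X′ Y : List ℤ} → X ⊆ X′ → Alternatives n k X Y → Alternatives n k X′ Y
alternatives-⊆ X⊆X′ (inj₁ (xs , ys , I)) = inj₁ (xs , ys , interleaved-⊆ X⊆X′ I)
alternatives-⊆ X⊆X′ (inj₂ (xs , chain)) = inj₂ (xs , gapChain-⊆ X⊆X′ chain)

interleaved-single : ∀ {X Y : List ℤ} {x y : ℤ} → x ∈ X → y ∈ Y → x < y
  → Interleaved 1 X Y (λ _ → x) (λ _ → y)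
interleaved-single x∈X y∈Y x<y = (λ _ → x∈X) , (λ _ → y∈Y) , (λ _ → x<y) , λ { zero zero () }

interleaved-cons : ∀ {n} {X Y : List ℤ} {x y : ℤ} {xs ys : Fin (suc n) → ℤ}
  → x ∈ X → y ∈ Y → x < y → y < xs zero
  → Interleaved (suc n) X Y xs ys → Interleaved (suc (suc n)) X Y (x ∷ᶠ xs) (y ∷ᶠ ys)
interleaved-cons {n} {X} {x = x} {y} {xs} {ys} x∈X y∈Y x<y y<xs₀ (xs∈X , ys∈Y , xs<ys , ys<next) =
  members , (λ { zero → y∈Y ; (suc i) → ys∈Y i }) , (λ { zero → x<y ; (suc i) → xs<ys i }) , links
  where
  members : ∀ i → (x ∷ᶠ xs) i ∈ X
  members zero = x∈X
  members (suc i) = xs∈X i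
  links : ∀ (i j : Fin (suc (suc n))) → toℕ j ≡ suc (toℕ i)
    → (y ∷ᶠ ys) i < (x ∷ᶠ xs) j
  links zero (suc zero) _ = y<xs₀
  links (suc i) (suc j) j≡i+1 = ys<next i j (ℕ.suc-injective j≡i+1)
  links zero zero ()
  links zero (suc (suc j)) ()
  links (suc i) zero ()

record Window (k : ℕ) (M : List ℤ) : Set where
  field
    chain      : Fin (suc k) → ℤ
    members    : ∀ i → chain i ∈ M
    increasing : ∀ (i : Fin k) → chain (inject₁ i) < chain (suc i)
    beyond     : All (chain (fromℕ k) <_) (drop (suc k) M)

window : ∀ k (M : List ℤ) → Increasing M → suc k ℕ.≤ length M → Window k M
window zero (c ∷ M) (c<M ∷ _) _ = record
  { chain = λ _ → c ; members = λ _ → here refl ; increasing = λ () ; beyond = c<M }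
window (suc k) (c ∷ M) (c<M ∷ M↑) (s≤s k<|M|) = record
  { chain      = c ∷ᶠ W.chain
  ; members    = λ { zero → here refl ; (suc i) → there (W.members i) }
  ; increasing = λ { zero → All.lookup c<M (W.members zero) ; (suc i) → W.increasing i }
  ; beyond     = W.beyond
  }
  where module W = Window (window k M M↑ k<|M|)

pointIn-or-gap : (Y : List ℤ) (lo hi : ℤ)
  → (∃ λ y → y ∈ Y × lo ≤ y × y ≤ hi) ⊎ (∀ y → y ∈ Y → ¬ (lo ≤ y × y ≤ hi))
pointIn-or-gap Y lo hi with any? (λ y → (lo ≤? y) ×-dec (y ≤? hi)) Y
... | yes some = let (y , y∈Y , inside) = find some in inj₁ (y , y∈Y , inside)
... | no none = inj₂ (λ y y∈Y inside → none (lose y∈Y inside))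

window-fits : ∀ n k (M : List ℤ) → suc n * (suc k + 1) ℕ.≤ suc (length M) → suc k ℕ.≤ length M
window-fits n k M (s≤s bound) =
  ℕ.≤-trans (ℕ.≤-reflexive (ℕ.+-comm 1 k)) (ℕ.≤-trans (ℕ.m≤m+n (k + 1) _) bound)

remaining-length : ∀ n k (M : List ℤ) → suc n * (suc k + 1) ℕ.≤ suc (length M)
  → n * (suc k + 1) ℕ.≤ length (drop (suc k) M)
remaining-length n k M (s≤s bound) =
  subst (_ ℕ.≤_) (sym (length-drop (suc k) M))
    (ℕ.m+n≤o⇒m≤o∸n (n * (suc k + 1))
      (subst (ℕ._≤ length M) (trans (ℕ.+-comm (k + 1) _) (cong (n * (suc k + 1) +_) (ℕ.+-comm k 1))) bound))

alternatives : (n k : ℕ) (Y L : List ℤ) → Increasing L → length L ≥ suc n * (suc k + 1)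
  → Alternatives n k L Y
alternatives n k Y (b ∷ M) (b<M ∷ M↑) bound =
  decide (pointIn-or-gap Y (W.chain zero) (W.chain (fromℕ k)))
  where
  module W = Window (window k M M↑ (window-fits n k M bound))
  R = drop (suc k) M
  R⊆L : R ⊆ b ∷ M
  R⊆L r∈R = there (Sublist.lookup (drop-⊆ (suc k) M) r∈R)
  extend : ∀ n (y : ℤ) → y ∈ Y → b < y → All (y <_) R → length R ≥ n * (suc k + 1)
    → Alternatives n k (b ∷ M) Y
  extend zero y y∈Y b<y _ _ = inj₁ (_ , _ , interleaved-single (here refl) y∈Y b<y)
  extend (suc n) y y∈Y b<y y<R |R|-bound with alternatives n k Y R (AllPairsₚ.drop⁺ (suc k) M↑) |R|-bound
  ... | inj₂ (xs , chain) = inj₂ (xs , gapChain-⊆ R⊆L chain)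
  ... | inj₁ (xs , ys , I@(xs∈R , _)) =
    inj₁ (_ , _ , interleaved-cons (here refl) y∈Y b<y (All.lookup y<R (xs∈R zero)) (interleaved-⊆ R⊆L I))
  decide : (∃ λ y → y ∈ Y × W.chain zero ≤ y × y ≤ W.chain (fromℕ k))
           ⊎ (∀ y → y ∈ Y → ¬ (W.chain zero ≤ y × y ≤ W.chain (fromℕ k)))
    → Alternatives n k (b ∷ M) Y
  decide (inj₂ gap) = inj₂ (W.chain , (λ i → there (W.members i)) , W.increasing , gap)
  decide (inj₁ (y , y∈Y , first≤y , y≤last)) =
    extend n y y∈Y (ℤ.<-≤-trans (All.lookup b<M (W.members zero)) first≤y)
      (All.map (ℤ.≤-<-trans y≤last) W.beyond) (remaining-length n k M bound)

sort-increasing : (X : List ℤ) → Unique X → Increasing (sort X)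
sort-increasing X X-unique = AllPairs.zipWith (λ (x≤y , x≢y) → ℤ.≤∧≢⇒< x≤y x≢y)
  (Linked⇒AllPairs ℤ.≤-trans (sort-↗ X) , sort-unique)
  where
  sort-unique : Unique (sort X)
  sort-unique = Permutationₛ.Unique-resp-↭ (setoid ℤ) (↭⇒↭ₛ (↭-sym (sort-↭ X))) X-unique

lemma3p2 : (n k : ℕ) → (X Y : List ℤ) → Unique X → Unique Y
    → length X ≥ suc n * (suc k + 1)
    → (∃₂ λ (xs ys : Fin (suc n) → ℤ) → Interleaved (suc n) X Y xs ys)
    ⊎ (∃ λ (xs : Fin (suc k) → ℤ) → GapChain k X Y xs)
lemma3p2 n k X Y X-unique _ |X|-bound =
  alternatives-⊆ (∈-resp-↭ (sort-↭ X))
    (alternatives n k Y (sort X) (sort-increasing X X-unique)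
      (subst (_ ℕ.≤_) (sym (↭-length (sort-↭ X))) |X|-bound))
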